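{- For any finite simple graph $G$, $\alpha(G)=\alpha'(G)$ if and only if $\tau(G)=\mu(G)$.
   Context: For a graph $G$ and $S\subseteq V(G)$, $N(S)=\bigcup_{u\in S}N(u)$. $\alpha(G)$ is the independence number, $\tau(G)$ the vertex covering number (minimum size of a set of vertices meeting every edge), and $\mu(G)$ the matching number (maximum size of a set of pairwise non-incident edges). An independent set $I_c$ is a critical independent set if $|I_c|-|N(I_c)|\ge |J|-|N(J)|$ for every independent set $J$ of $G$; the critical independence number $\alpha'(G)$ is the maximum cardinality of a critical independent set. -}

module Defs where

open import Data.Nat using (ℕ; zero; suc; _≤_)
open import Data.Bool using (Bool; true; false; _∧_; _∨_)
open import Data.Fin using (Fin; zero; suc)
open import Data.Fin.Subset using (Subset; _∈_; ∣_∣)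
open import Data.Vec using (tabulate; lookup)
open import Data.Integer using (ℤ; _⊖_; _≥_)
open import Data.List using (List; length)
open import Data.List.Relation.Unary.All using (All)
open import Data.List.Relation.Unary.AllPairs using (AllPairs)
open import Data.Product using (_×_; _,_; Σ)
open import Data.Sum using (_⊎_)
open import Relation.Binary.PropositionalEquality using (_≡_; _≢_)

record Graph (n : ℕ) : Set where
  field
    adj    : Fin n → Fin n → Bool
    sym    : ∀ u v → adj u v ≡ adj v u
    irrefl : ∀ u → adj u u ≡ false
open Graph public

anyFin : ∀ {n} → (Fin n → Bool) → Bool
anyFin {zero}  f = false
anyFin {suc n} f = f zero ∨ anyFin (λ i → f (suc i))

N : ∀ {n} → Graph n → Subset n → Subset n
N G S = tabulate (λ v → anyFin (λ u → lookup S u ∧ adj G u v))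

Independent : ∀ {n} → Graph n → Subset n → Set
Independent G S = ∀ u v → u ∈ S → v ∈ S → adj G u v ≡ false

surplus : ∀ {n} → Graph n → Subset n → ℤ
surplus G S = ∣ S ∣ ⊖ ∣ N G S ∣

CriticalIndependent : ∀ {n} → Graph n → Subset n → Set
CriticalIndependent G I =
  Independent G I × (∀ J → Independent G J → surplus G I ≥ surplus G J)

VertexCover : ∀ {n} → Graph n → Subset n → Set
VertexCover G C = ∀ u v → adj G u v ≡ true → u ∈ C ⊎ v ∈ C

NonIncident : ∀ {n} → Fin n × Fin n → Fin n × Fin n → Set
NonIncident (u , v) (x , y) = u ≢ x × u ≢ y × v ≢ x × v ≢ y

Matching : ∀ {n} → Graph n → List (Fin n × Fin n) → Set
Matching G M =
  All (λ e → adj G (Data.Product.proj₁ e) (Data.Product.proj₂ e) ≡ true) M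
  × AllPairs NonIncident M

IsIndependenceNumber : ∀ {n} → Graph n → ℕ → Set
IsIndependenceNumber G k =
  Σ (Subset _) (λ S → Independent G S × ∣ S ∣ ≡ k)
  × (∀ S → Independent G S → ∣ S ∣ ≤ k)

IsCriticalIndependenceNumber : ∀ {n} → Graph n → ℕ → Set
IsCriticalIndependenceNumber G k =
  Σ (Subset _) (λ S → CriticalIndependent G S × ∣ S ∣ ≡ k)
  × (∀ S → CriticalIndependent G S → ∣ S ∣ ≤ k)

IsVertexCoverNumber : ∀ {n} → Graph n → ℕ → Set
IsVertexCoverNumber G k =
  Σ (Subset _) (λ C → VertexCover G C × ∣ C ∣ ≡ k)
  × (∀ C → VertexCover G C → k ≤ ∣ C ∣)

IsMatchingNumber : ∀ {n} → Graph n → ℕ → Set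
IsMatchingNumber G k =
  Σ (List _) (λ M → Matching G M × length M ≡ k)
  × (∀ M → Matching G M → length M ≤ k)

-- The proof combines four classical facts, developed in this order:
--   * Gallai: α + τ = n, because complements exchange independent sets and
--     vertex covers;
--   * weak duality μ ≤ τ, and the surplus bound |J| − |N(J)| ≤ n − 2|M| for
--     every independent J and matching M (an independent set meets each
--     matching edge at most once, and then N(J) meets it too);
--   * Hall's marriage theorem, proved by the usual induction that splits
--     either at a tight set or at a single matched vertex;
--   * Larson: N(I) can be matched into every critical independent set I.
-- (⇐) If τ = μ, a maximum independent set S and a maximum matching M have
--     |S| + |M| = α + τ = n, and the surplus bound then makes S critical.
-- (⇒) If α = α′, some critical independent set I is maximum, hence dominates
--     (∁ I ⊆ N(I)); Larson's matching then has at least n − α = τ edges.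
module Submission where

open import Data.Nat using (ℕ; zero; suc; _+_; _≤_; _<_; z≤n; s≤s; _≤?_; _<?_)
open import Data.Nat.Properties
open import Data.Bool using (Bool; true; false; _∧_)
open import Data.Fin using (Fin; zero; suc)
import Data.Fin.Properties as Fin
open import Data.Fin.Subset
open import Data.Fin.Subset.Properties
open import Data.Vec using ([]; _∷_; here; there; tabulate)
open import Data.Vec.Properties using (lookup∘tabulate; []=⇒lookup; lookup⇒[]=)
open import Data.Nat.Tactic.RingSolver using (solve-∀)
open import Data.Integer as ℤ using (_⊖_)
import Data.Integer.Properties as ℤ
open import Data.List as List using (List; []; _∷_; length)
open import Data.List.Properties using (length-map)
open import Data.List.Relation.Unary.All as All using (All; []; _∷_)
import Data.List.Relation.Unary.All.Properties as All
open import Data.List.Relation.Unary.AllPairs as AllPairs using (AllPairs; []; _∷_)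
import Data.List.Relation.Unary.AllPairs.Properties as AllPairs
open import Data.Product using (∃-syntax; _×_; _,_; proj₁; proj₂)
open import Data.Sum using (_⊎_; inj₁; inj₂; [_,_]′)
open import Function using (_∘_)
open import Function.Bundles using (_⇔_; mk⇔)
open import Relation.Binary.PropositionalEquality
open import Relation.Nullary using (¬_; Dec; yes; no; contradiction)
open import Relation.Nullary.Decidable using (_×-dec_)
open import Defs hiding (sym)
import Defs as Graph

private
  variable
    n : ℕ
    x u v : Fin n
    p q : Subset n

Disjoint : Subset n → Subset n → Set
Disjoint p q = ∀ {x} → x ∈ p → x ∉ q

∣p∣≡∣p∩q∣+∣p─q∣ : ∀ (p q : Subset n) → ∣ p ∣ ≡ ∣ p ∩ q ∣ + ∣ p ─ q ∣
∣p∣≡∣p∩q∣+∣p─q∣ []            []            = refl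
∣p∣≡∣p∩q∣+∣p─q∣ (inside  ∷ p) (inside  ∷ q) = cong suc (∣p∣≡∣p∩q∣+∣p─q∣ p q)
∣p∣≡∣p∩q∣+∣p─q∣ (inside  ∷ p) (outside ∷ q) =
  trans (cong suc (∣p∣≡∣p∩q∣+∣p─q∣ p q)) (sym (+-suc _ _))
∣p∣≡∣p∩q∣+∣p─q∣ (outside ∷ p) (inside  ∷ q) = ∣p∣≡∣p∩q∣+∣p─q∣ p q
∣p∣≡∣p∩q∣+∣p─q∣ (outside ∷ p) (outside ∷ q) = ∣p∣≡∣p∩q∣+∣p─q∣ p q

∣p∪q∣≡∣p∣+∣q∣ : ∀ (p q : Subset n) → Disjoint p q → ∣ p ∪ q ∣ ≡ ∣ p ∣ + ∣ q ∣
∣p∪q∣≡∣p∣+∣q∣ []            []            _ = refl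
∣p∪q∣≡∣p∣+∣q∣ (inside  ∷ p) (inside  ∷ q) d = contradiction here (d here)
∣p∪q∣≡∣p∣+∣q∣ (inside  ∷ p) (outside ∷ q) d =
  cong suc (∣p∪q∣≡∣p∣+∣q∣ p q (λ x∈p x∈q → d (there x∈p) (there x∈q)))
∣p∪q∣≡∣p∣+∣q∣ (outside ∷ p) (inside  ∷ q) d =
  trans (cong suc (∣p∪q∣≡∣p∣+∣q∣ p q (λ x∈p x∈q → d (there x∈p) (there x∈q))))
        (sym (+-suc _ _))
∣p∪q∣≡∣p∣+∣q∣ (outside ∷ p) (outside ∷ q) d =
  ∣p∪q∣≡∣p∣+∣q∣ p q (λ x∈p x∈q → d (there x∈p) (there x∈q))

∣p∪q∣≤∣p∣+∣q∣ : ∀ (p q : Subset n) → ∣ p ∪ q ∣ ≤ ∣ p ∣ + ∣ q ∣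
∣p∪q∣≤∣p∣+∣q∣ []            []            = z≤n
∣p∪q∣≤∣p∣+∣q∣ (inside  ∷ p) (inside  ∷ q) =
  s≤s (≤-trans (∣p∪q∣≤∣p∣+∣q∣ p q) (+-monoʳ-≤ ∣ p ∣ (n≤1+n ∣ q ∣)))
∣p∪q∣≤∣p∣+∣q∣ (inside  ∷ p) (outside ∷ q) = s≤s (∣p∪q∣≤∣p∣+∣q∣ p q)
∣p∪q∣≤∣p∣+∣q∣ (outside ∷ p) (inside  ∷ q) =
  subst (suc ∣ p ∪ q ∣ ≤_) (sym (+-suc ∣ p ∣ ∣ q ∣)) (s≤s (∣p∪q∣≤∣p∣+∣q∣ p q))
∣p∪q∣≤∣p∣+∣q∣ (outside ∷ p) (outside ∷ q) = ∣p∪q∣≤∣p∣+∣q∣ p q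

x∈p─q⇒x∉q : x ∈ p ─ q → x ∉ q
x∈p─q⇒x∉q {p = _ ∷ p} {q = outside ∷ q} (there x∈p─q) (there x∈q) = x∈p─q⇒x∉q x∈p─q x∈q
x∈p─q⇒x∉q {p = _ ∷ p} {q = inside  ∷ q} (there x∈p─q) (there x∈q) = x∈p─q⇒x∉q x∈p─q x∈q

∣p∣+∣∁p∣≡n : ∀ (p : Subset n) → ∣ p ∣ + ∣ ∁ p ∣ ≡ n
∣p∣+∣∁p∣≡n p = trans (cong (∣ p ∣ +_) (∣∁p∣≡n∸∣p∣ p)) (m+[n∸m]≡n (∣p∣≤n p))

∣p∣+∣q─p∣≡∣q∣ : ∀ {p q : Subset n} → p ⊆ q → ∣ p ∣ + ∣ q ─ p ∣ ≡ ∣ q ∣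
∣p∣+∣q─p∣≡∣q∣ {p = p} {q} p⊆q = begin
  ∣ p ∣ + ∣ q ─ p ∣       ≡⟨ cong (λ r → ∣ r ∣ + ∣ q ─ p ∣) q∩p≡p ⟨
  ∣ q ∩ p ∣ + ∣ q ─ p ∣   ≡⟨ ∣p∣≡∣p∩q∣+∣p─q∣ q p ⟨
  ∣ q ∣                   ∎
  where
  open ≡-Reasoning
  q∩p≡p : q ∩ p ≡ p
  q∩p≡p = ⊆-antisym (p∩q⊆q q p) (λ x∈p → x∈p∩q⁺ (p⊆q x∈p , x∈p))

x∈p⇒1≤∣p∣ : x ∈ p → 1 ≤ ∣ p ∣
x∈p⇒1≤∣p∣ {x = x} {p} x∈p = subst (_≤ ∣ p ∣) (∣⁅x⁆∣≡1 x)
  (p⊆q⇒∣p∣≤∣q∣ (λ y∈⁅x⁆ → subst (_∈ p) (sym (x∈⁅y⁆⇒x≡y x y∈⁅x⁆)) x∈p))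

1≤∣p∣⇒Nonempty : 1 ≤ ∣ p ∣ → Nonempty p
1≤∣p∣⇒Nonempty {n} {p} 1≤∣p∣ with nonempty? p
... | yes ne = ne
... | no  ¬ne = contradiction (trans (cong ∣_∣ (Empty-unique ¬ne)) (∣⊥∣≡0 n))
                              (m<n⇒n≢0 1≤∣p∣)

-- The elements of a subset as a duplicate-free list; used to turn an
-- injective assignment of partners into a list of edges.

members : Subset n → List (Fin n)
members []            = []
members (inside  ∷ p) = zero ∷ List.map suc (members p)
members (outside ∷ p) = List.map suc (members p)

length-members : ∀ (p : Subset n) → length (members p) ≡ ∣ p ∣
length-members []            = refl
length-members (inside  ∷ p) = cong suc (trans (length-map suc (members p)) (length-members p))
length-members (outside ∷ p) = trans (length-map suc (members p)) (length-members p)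

members-∈ : ∀ (p : Subset n) → All (_∈ p) (members p)
members-∈ []            = []
members-∈ (inside  ∷ p) = here ∷ All.map⁺ (All.map there (members-∈ p))
members-∈ (outside ∷ p) = All.map⁺ (All.map there (members-∈ p))

map-suc-distinct : ∀ {xs : List (Fin n)} → AllPairs _≢_ xs → AllPairs _≢_ (List.map suc xs)
map-suc-distinct distinct = AllPairs.map⁺ (AllPairs.map (λ x≢y → x≢y ∘ Fin.suc-injective) distinct)

members-distinct : ∀ (p : Subset n) → AllPairs _≢_ (members p)
members-distinct []            = []
members-distinct (inside  ∷ p) =
  All.map⁺ (All.universal (λ _ ()) (members p)) ∷ map-suc-distinct (members-distinct p)
members-distinct (outside ∷ p) = map-suc-distinct (members-distinct p)

⊖-+-cancel : ∀ c d e → (c ⊖ d) ℤ.+ ℤ.+ (e + d) ≡ ℤ.+ (c + e)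
⊖-+-cancel c d e = begin
  (c ⊖ d) ℤ.+ ℤ.+ (e + d)  ≡⟨ ℤ.distribˡ-⊖-+-pos (e + d) c d ⟩
  (c + (e + d)) ⊖ d        ≡⟨ cong₂ _⊖_ (rearrange c d e) (sym (+-identityʳ d)) ⟩
  (d + (c + e)) ⊖ (d + 0)  ≡⟨ ℤ.+-cancelˡ-⊖ d (c + e) 0 ⟩
  ℤ.+ (c + e)              ∎
  where
  open ≡-Reasoning
  rearrange : ∀ c d e → c + (e + d) ≡ d + (c + e)
  rearrange = solve-∀

⊖-≤⇒ : ∀ a b c d → (c ⊖ d) ℤ.≤ (a ⊖ b) → c + b ≤ a + d
⊖-≤⇒ a b c d le = ℤ.drop‿+≤+ (subst₂ ℤ._≤_ (⊖-+-cancel c d b) rhs (ℤ.+-monoˡ-≤ (ℤ.+ (b + d)) le))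
  where
  rhs : (a ⊖ b) ℤ.+ ℤ.+ (b + d) ≡ ℤ.+ (a + d)
  rhs = trans (cong (λ k → (a ⊖ b) ℤ.+ ℤ.+ k) (+-comm b d)) (⊖-+-cancel a b d)

⇒⊖-≤ : ∀ a b c d → c + b ≤ a + d → (c ⊖ d) ℤ.≤ (a ⊖ b)
⇒⊖-≤ a b c d le = subst₂ ℤ._≤_ (ℤ.+-cancelˡ-⊖ b c d)
  (trans (cong ((d + a) ⊖_) (+-comm b d)) (ℤ.+-cancelˡ-⊖ d a b))
  (ℤ.⊖-monoˡ-≤ (b + d) (subst₂ _≤_ (+-comm c b) (+-comm a d) le))

ends : Fin n × Fin n → Subset n
ends (u , v) = ⁅ u ⁆ ∪ ⁅ v ⁆

covered : List (Fin n × Fin n) → Subset n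
covered []      = ⊥
covered (e ∷ M) = ends e ∪ covered M

∈ends⁻ : x ∈ ends (u , v) → x ≡ u ⊎ x ≡ v
∈ends⁻ {u = u} {v} x∈ends with x∈p∪q⁻ ⁅ u ⁆ ⁅ v ⁆ x∈ends
... | inj₁ x∈⁅u⁆ = inj₁ (x∈⁅y⁆⇒x≡y u x∈⁅u⁆)
... | inj₂ x∈⁅v⁆ = inj₂ (x∈⁅y⁆⇒x≡y v x∈⁅v⁆)

∣ends∣≡2 : u ≢ v → ∣ ends (u , v) ∣ ≡ 2
∣ends∣≡2 {u = u} {v} u≢v = trans
  (∣p∪q∣≡∣p∣+∣q∣ ⁅ u ⁆ ⁅ v ⁆ λ x∈⁅u⁆ x∈⁅v⁆ →
     u≢v (trans (sym (x∈⁅y⁆⇒x≡y u x∈⁅u⁆)) (x∈⁅y⁆⇒x≡y v x∈⁅v⁆)))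
  (cong₂ _+_ (∣⁅x⁆∣≡1 u) (∣⁅x⁆∣≡1 v))

∉covered : ∀ M → All (λ e → x ≢ proj₁ e × x ≢ proj₂ e) M → x ∉ covered M
∉covered []            []                  x∈ = ∉⊥ x∈
∉covered ((u , v) ∷ M) ((x≢u , x≢v) ∷ avoids) x∈ with x∈p∪q⁻ (ends (u , v)) _ x∈
... | inj₁ x∈ends = [ x≢u , x≢v ]′ (∈ends⁻ x∈ends)
... | inj₂ x∈M    = ∉covered M avoids x∈M

ends-disjoint : ∀ {e : Fin n × Fin n} M → All (NonIncident e) M → Disjoint (ends e) (covered M)
ends-disjoint M nonIncident x∈ends with ∈ends⁻ x∈ends
... | inj₁ refl = ∉covered M (All.map (λ { {_ , _} (ux , uy , _ , _) → ux , uy }) nonIncident)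
... | inj₂ refl = ∉covered M (All.map (λ { {_ , _} (_ , _ , vx , vy) → vx , vy }) nonIncident)

∣A∩covered∣-∷ : ∀ (A : Subset n) e M → Disjoint (ends e) (covered M) →
               ∣ A ∩ covered (e ∷ M) ∣ ≡ ∣ A ∩ ends e ∣ + ∣ A ∩ covered M ∣
∣A∩covered∣-∷ A e M disjoint = trans
  (cong ∣_∣ (∩-distribˡ-∪ A (ends e) (covered M)))
  (∣p∪q∣≡∣p∣+∣q∣ _ _ λ x∈A∩e x∈A∩M →
     disjoint (proj₂ (x∈p∩q⁻ A _ x∈A∩e)) (proj₂ (x∈p∩q⁻ A _ x∈A∩M)))

covered-mono : ∀ (A B : Subset n) M → AllPairs NonIncident M →
               All (λ e → ∣ A ∩ ends e ∣ ≤ ∣ B ∩ ends e ∣) M →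
               ∣ A ∩ covered M ∣ ≤ ∣ B ∩ covered M ∣
covered-mono A B []      []           []       =
  p⊆q⇒∣p∣≤∣q∣ {q = B ∩ ⊥} λ x∈A∩⊥ → contradiction (proj₂ (x∈p∩q⁻ A ⊥ x∈A∩⊥)) ∉⊥
covered-mono A B (e ∷ M) (ni ∷ pairs) (le ∷ les) = begin
  ∣ A ∩ covered (e ∷ M) ∣             ≡⟨ ∣A∩covered∣-∷ A e M (ends-disjoint M ni) ⟩
  ∣ A ∩ ends e ∣ + ∣ A ∩ covered M ∣  ≤⟨ +-mono-≤ le (covered-mono A B M pairs les) ⟩
  ∣ B ∩ ends e ∣ + ∣ B ∩ covered M ∣  ≡⟨ ∣A∩covered∣-∷ B e M (ends-disjoint M ni) ⟨
  ∣ B ∩ covered (e ∷ M) ∣             ∎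
  where open ≤-Reasoning

length≤∣C∩covered∣ : ∀ (C : Subset n) M → AllPairs NonIncident M →
                     All (λ e → 1 ≤ ∣ C ∩ ends e ∣) M → length M ≤ ∣ C ∩ covered M ∣
length≤∣C∩covered∣ C []      []           []         = z≤n
length≤∣C∩covered∣ C (e ∷ M) (ni ∷ pairs) (1≤ ∷ 1≤s) = begin
  1 + length M                        ≤⟨ +-mono-≤ 1≤ (length≤∣C∩covered∣ C M pairs 1≤s) ⟩
  ∣ C ∩ ends e ∣ + ∣ C ∩ covered M ∣  ≡⟨ ∣A∩covered∣-∷ C e M (ends-disjoint M ni) ⟨
  ∣ C ∩ covered (e ∷ M) ∣             ∎
  where open ≤-Reasoning

∈tabulate⁺ : ∀ (f : Fin n → Bool) → f x ≡ true → x ∈ tabulate f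
∈tabulate⁺ {x = x} f fx = lookup⇒[]= x (tabulate f) (trans (lookup∘tabulate f x) fx)

∈tabulate⁻ : ∀ (f : Fin n → Bool) → x ∈ tabulate f → f x ≡ true
∈tabulate⁻ {x = x} f x∈ = trans (sym (lookup∘tabulate f x)) ([]=⇒lookup x∈)

anyFin⁺ : ∀ (f : Fin n → Bool) i → f i ≡ true → anyFin f ≡ true
anyFin⁺ f zero    fi rewrite fi = refl
anyFin⁺ f (suc i) fi with f zero
... | true  = refl
... | false = anyFin⁺ (λ j → f (suc j)) i fi

anyFin⁻ : ∀ (f : Fin n → Bool) → anyFin f ≡ true → ∃[ i ] f i ≡ true
anyFin⁻ {suc n} f any with f zero in f0
... | true  = zero , f0
... | false = let (i , fi) = anyFin⁻ (λ j → f (suc j)) any in suc i , fi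

∧-true⁻ : ∀ {a b} → (a ∧ b) ≡ true → a ≡ true × b ≡ true
∧-true⁻ {true} b≡true = refl , b≡true

module _ {n : ℕ} (G : Graph n) where

  ∈N⁺ : ∀ {S u v} → u ∈ S → adj G u v ≡ true → v ∈ N G S
  ∈N⁺ {u = u} u∈S uv = ∈tabulate⁺ _ (anyFin⁺ _ u (cong₂ _∧_ ([]=⇒lookup u∈S) uv))

  ∈N⁻ : ∀ {S v} → v ∈ N G S → ∃[ u ] u ∈ S × adj G u v ≡ true
  ∈N⁻ {S} v∈NS with anyFin⁻ _ (∈tabulate⁻ _ v∈NS)
  ... | u , Su∧uv with ∧-true⁻ Su∧uv
  ...   | Su , uv = u , lookup⇒[]= u S Su , uv

  ∈N-sym : ∀ {S u v} → v ∈ S → adj G u v ≡ true → u ∈ N G S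
  ∈N-sym {u = u} {v} v∈S uv = ∈N⁺ v∈S (trans (Graph.sym G v u) uv)

  N-∪ : ∀ A B → N G (A ∪ B) ⊆ N G A ∪ N G B
  N-∪ A B v∈N with ∈N⁻ v∈N
  ... | u , u∈A∪B , uv with x∈p∪q⁻ A B u∈A∪B
  ...   | inj₁ u∈A = x∈p∪q⁺ (inj₁ (∈N⁺ u∈A uv))
  ...   | inj₂ u∈B = x∈p∪q⁺ (inj₂ (∈N⁺ u∈B uv))

  independent-⊆ : ∀ {S T} → T ⊆ S → Independent G S → Independent G T
  independent-⊆ T⊆S indS u v u∈T v∈T = indS u v (T⊆S u∈T) (T⊆S v∈T)

  independent⇒N-disjoint : ∀ {S} → Independent G S → Disjoint (N G S) S
  independent⇒N-disjoint indS v∈NS v∈S with ∈N⁻ v∈NS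
  ... | u , u∈S , uv = contradiction (trans (sym uv) (indS u _ u∈S v∈S)) λ ()

  independent⇒∁-cover : ∀ {S} → Independent G S → VertexCover G (∁ S)
  independent⇒∁-cover {S} indS u v uv with u ∈? S | v ∈? S
  ... | yes u∈S | yes v∈S = contradiction (trans (sym uv) (indS u v u∈S v∈S)) λ ()
  ... | no  u∉S | _       = inj₁ (x∉p⇒x∈∁p u∉S)
  ... | yes _   | no  v∉S = inj₂ (x∉p⇒x∈∁p v∉S)

  cover⇒∁-independent : ∀ {C} → VertexCover G C → Independent G (∁ C)
  cover⇒∁-independent coverC u v u∈∁C v∈∁C with adj G u v in uv
  ... | false = refl
  ... | true with coverC u v uv
  ...   | inj₁ u∈C = contradiction u∈C (x∈∁p⇒x∉p u∈∁C)
  ...   | inj₂ v∈C = contradiction v∈C (x∈∁p⇒x∉p v∈∁C)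

  α+τ≡n : ∀ {a t} → IsIndependenceNumber G a → IsVertexCoverNumber G t → a + t ≡ n
  α+τ≡n {a} {t} ((S , indS , ∣S∣≡a) , maxα) ((C , coverC , ∣C∣≡t) , minτ) =
    ≤-antisym a+t≤n n≤a+t
    where
    open ≤-Reasoning
    a+t≤n : a + t ≤ n
    a+t≤n = begin
      a + t               ≤⟨ +-monoʳ-≤ a (minτ (∁ S) (independent⇒∁-cover indS)) ⟩
      a + ∣ ∁ S ∣         ≡⟨ cong (_+ ∣ ∁ S ∣) ∣S∣≡a ⟨
      ∣ S ∣ + ∣ ∁ S ∣     ≡⟨ ∣p∣+∣∁p∣≡n S ⟩
      n                   ∎
    n≤a+t : n ≤ a + t
    n≤a+t = begin
      n                   ≡⟨ ∣p∣+∣∁p∣≡n C ⟨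
      ∣ C ∣ + ∣ ∁ C ∣     ≤⟨ +-monoʳ-≤ ∣ C ∣ (maxα (∁ C) (cover⇒∁-independent coverC)) ⟩
      ∣ C ∣ + a           ≡⟨ cong (_+ a) ∣C∣≡t ⟩
      t + a               ≡⟨ +-comm t a ⟩
      a + t               ∎

  edge⇒≢ : ∀ {u v} → adj G u v ≡ true → u ≢ v
  edge⇒≢ {u} uv refl = contradiction (trans (sym uv) (irrefl G u)) λ ()

  ∣covered∣ : ∀ M → Matching G M → ∣ covered M ∣ ≡ length M + length M
  ∣covered∣ []            _                       = ∣⊥∣≡0 n
  ∣covered∣ ((u , v) ∷ M) (uv ∷ edges , ni ∷ pairs) = begin
    ∣ ends (u , v) ∪ covered M ∣      ≡⟨ ∣p∪q∣≡∣p∣+∣q∣ _ _ (ends-disjoint M ni) ⟩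
    ∣ ends (u , v) ∣ + ∣ covered M ∣  ≡⟨ cong₂ _+_ (∣ends∣≡2 (edge⇒≢ uv)) (∣covered∣ M (edges , pairs)) ⟩
    2 + (length M + length M)         ≡⟨ cong suc (+-suc (length M) (length M)) ⟨
    suc (length M) + suc (length M)   ∎
    where open ≡-Reasoning

  matching≤cover : ∀ {M C} → Matching G M → VertexCover G C → length M ≤ ∣ C ∣
  matching≤cover {M} {C} (edges , pairs) coverC =
    ≤-trans (length≤∣C∩covered∣ C M pairs (All.map meetsC edges)) (∣p∩q∣≤∣p∣ C (covered M))
    where
    meetsC : ∀ {e} → adj G (proj₁ e) (proj₂ e) ≡ true → 1 ≤ ∣ C ∩ ends e ∣
    meetsC {u , v} uv with coverC u v uv
    ... | inj₁ u∈C = x∈p⇒1≤∣p∣ (x∈p∩q⁺ (u∈C , x∈p∪q⁺ (inj₁ (x∈⁅x⁆ u))))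
    ... | inj₂ v∈C = x∈p⇒1≤∣p∣ (x∈p∩q⁺ (v∈C , x∈p∪q⁺ (inj₂ (x∈⁅x⁆ v))))

  -- If an independent set J contains the endpoint u of an edge uv, then J meets
  -- the edge only in u while N(J) contains v.
  independent-endpoint : ∀ {J u v} → Independent G J → u ∈ J → adj G u v ≡ true →
                         ∣ J ∩ ends (u , v) ∣ ≤ ∣ N G J ∩ ends (u , v) ∣
  independent-endpoint {J} {u} {v} indJ u∈J uv = begin
    ∣ J ∩ ends (u , v) ∣      ≤⟨ p⊆q⇒∣p∣≤∣q∣ J∩uv⊆⁅u⁆ ⟩
    ∣ ⁅ u ⁆ ∣                 ≡⟨ ∣⁅x⁆∣≡1 u ⟩
    1                         ≤⟨ x∈p⇒1≤∣p∣ (x∈p∩q⁺ (∈N⁺ u∈J uv , x∈p∪q⁺ (inj₂ (x∈⁅x⁆ v)))) ⟩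
    ∣ N G J ∩ ends (u , v) ∣  ∎
    where
    open ≤-Reasoning
    J∩uv⊆⁅u⁆ : J ∩ ends (u , v) ⊆ ⁅ u ⁆
    J∩uv⊆⁅u⁆ x∈ with x∈p∩q⁻ J _ x∈
    ... | x∈J , x∈uv with ∈ends⁻ x∈uv
    ...   | inj₁ refl = x∈⁅x⁆ u
    ...   | inj₂ refl = contradiction (trans (sym uv) (indJ u v u∈J x∈J)) λ ()

  independent-edge : ∀ {J u v} → Independent G J → adj G u v ≡ true →
                     ∣ J ∩ ends (u , v) ∣ ≤ ∣ N G J ∩ ends (u , v) ∣
  independent-edge {J} {u} {v} indJ uv with u ∈? J | v ∈? J
  ... | yes u∈J | _       = independent-endpoint indJ u∈J uv
  ... | no  _   | yes v∈J =
    subst (λ e → ∣ J ∩ e ∣ ≤ ∣ N G J ∩ e ∣) (∪-comm ⁅ v ⁆ ⁅ u ⁆)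
          (independent-endpoint indJ v∈J (trans (Graph.sym G v u) uv))
  ... | no  u∉J | no  v∉J = subst (_≤ ∣ N G J ∩ ends (u , v) ∣) (sym ∣J∩uv∣≡0) z≤n
    where
    J∩uv-empty : Empty (J ∩ ends (u , v))
    J∩uv-empty (x , x∈) with x∈p∩q⁻ J _ x∈
    ... | x∈J , x∈uv = [ (λ { refl → u∉J x∈J }) , (λ { refl → v∉J x∈J }) ]′ (∈ends⁻ x∈uv)
    ∣J∩uv∣≡0 : ∣ J ∩ ends (u , v) ∣ ≡ 0
    ∣J∩uv∣≡0 = trans (cong ∣_∣ (Empty-unique J∩uv-empty)) (∣⊥∣≡0 n)

  ∣J∣≤∣NJ∣+uncovered : ∀ {J M} → Independent G J → Matching G M →
                       ∣ J ∣ ≤ ∣ N G J ∣ + ∣ ∁ (covered M) ∣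
  ∣J∣≤∣NJ∣+uncovered {J} {M} indJ (edges , pairs) = begin
    ∣ J ∣                                    ≡⟨ ∣p∣≡∣p∩q∣+∣p─q∣ J (covered M) ⟩
    ∣ J ∩ covered M ∣ + ∣ J ─ covered M ∣    ≤⟨ +-mono-≤ matched unmatched ⟩
    ∣ N G J ∣ + ∣ ∁ (covered M) ∣            ∎
    where
    open ≤-Reasoning
    matched : ∣ J ∩ covered M ∣ ≤ ∣ N G J ∣
    matched = ≤-trans
      (covered-mono J (N G J) M pairs (All.map (λ { {_ , _} → independent-edge indJ }) edges))
      (∣p∩q∣≤∣p∣ (N G J) (covered M))
    unmatched : ∣ J ─ covered M ∣ ≤ ∣ ∁ (covered M) ∣
    unmatched = p⊆q⇒∣p∣≤∣q∣ {p = J ─ covered M} (λ x∈ → x∉p⇒x∈∁p (x∈p─q⇒x∉q x∈))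

module _ {n : ℕ} (G : Graph n) where

  record SDR (X Y : Subset n) : Set where
    field
      rep     : Fin n → Fin n
      rep-adj : ∀ {x} → x ∈ X → adj G x (rep x) ≡ true
      rep-∈   : ∀ {x} → x ∈ X → rep x ∈ Y
      rep-inj : ∀ {x x′} → x ∈ X → x′ ∈ X → rep x ≡ rep x′ → x ≡ x′
  open SDR

  HallCondition : Subset n → Subset n → Set
  HallCondition X Y = ∀ A → A ⊆ X → ∣ A ∣ ≤ ∣ Y ∩ N G A ∣

  sdr-empty : ∀ {X Y} → Empty X → SDR X Y
  sdr-empty empty = record
    { rep     = λ x → x
    ; rep-adj = λ x∈X → contradiction (_ , x∈X) empty
    ; rep-∈   = λ x∈X → contradiction (_ , x∈X) empty
    ; rep-inj = λ x∈X _ _ → contradiction (_ , x∈X) empty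
    }

  sdr-weaken : ∀ {X Y Y′} → SDR X Y → Y ⊆ Y′ → SDR X Y′
  sdr-weaken s Y⊆Y′ = record
    { rep = rep s ; rep-adj = rep-adj s ; rep-∈ = λ x∈X → Y⊆Y′ (rep-∈ s x∈X) ; rep-inj = rep-inj s }

  sdr-glue : ∀ {X A Y} (s : SDR A Y) (t : SDR (X ─ A) Y) →
             (∀ {x x′} → x ∈ A → x′ ∈ X ─ A → rep s x ≢ rep t x′) → SDR X Y
  sdr-glue {X} {A} {Y} s t apart = record
    { rep = glued ; rep-adj = glued-adj ; rep-∈ = glued-∈ ; rep-inj = glued-inj }
    where
    glued : Fin n → Fin n
    glued x with x ∈? A
    ... | yes _ = rep s x
    ... | no  _ = rep t x
    glued-adj : ∀ {x} → x ∈ X → adj G x (glued x) ≡ true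
    glued-adj {x} x∈X with x ∈? A
    ... | yes x∈A = rep-adj s x∈A
    ... | no  x∉A = rep-adj t (x∈p∧x∉q⇒x∈p─q x∈X x∉A)
    glued-∈ : ∀ {x} → x ∈ X → glued x ∈ Y
    glued-∈ {x} x∈X with x ∈? A
    ... | yes x∈A = rep-∈ s x∈A
    ... | no  x∉A = rep-∈ t (x∈p∧x∉q⇒x∈p─q x∈X x∉A)
    glued-inj : ∀ {x x′} → x ∈ X → x′ ∈ X → glued x ≡ glued x′ → x ≡ x′
    glued-inj {x} {x′} x∈X x′∈X same with x ∈? A | x′ ∈? A
    ... | yes x∈A | yes x′∈A = rep-inj s x∈A x′∈A same
    ... | yes x∈A | no  x′∉A = contradiction same (apart x∈A (x∈p∧x∉q⇒x∈p─q x′∈X x′∉A))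
    ... | no  x∉A | yes x′∈A = contradiction (sym same) (apart x′∈A (x∈p∧x∉q⇒x∈p─q x∈X x∉A))
    ... | no  x∉A | no  x′∉A =
      rep-inj t (x∈p∧x∉q⇒x∈p─q x∈X x∉A) (x∈p∧x∉q⇒x∈p─q x′∈X x′∉A) same

  Tight : Subset n → Subset n → Subset n → Set
  Tight X Y A = A ⊆ X × 1 ≤ ∣ A ∣ × ∣ A ∣ < ∣ X ∣ × ∣ Y ∩ N G A ∣ ≤ ∣ A ∣

  tight? : ∀ X Y A → Dec (Tight X Y A)
  tight? X Y A = A ⊆? X ×-dec 1 ≤? ∣ A ∣ ×-dec ∣ A ∣ <? ∣ X ∣ ×-dec ∣ Y ∩ N G A ∣ ≤? ∣ A ∣

  HallBelow : ℕ → Set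
  HallBelow k = ∀ X Y → ∣ X ∣ ≤ k → HallCondition X Y → SDR X Y

  -- After matching a tight set A into Y, Hall's condition still holds for
  -- X ─ A in Y ─ N(A): the neighbours of A in Y are all needed by A itself.
  hall-outside-tight : ∀ {X Y A} → HallCondition X Y → A ⊆ X → ∣ Y ∩ N G A ∣ ≤ ∣ A ∣ →
                       HallCondition (X ─ A) (Y ─ N G A)
  hall-outside-tight {X} {Y} {A} hallXY A⊆X tightA B B⊆X─A = +-cancelˡ-≤ ∣ A ∣ _ _ (begin
    ∣ A ∣ + ∣ B ∣                                   ≡⟨ ∣p∪q∣≡∣p∣+∣q∣ A B A-B-disjoint ⟨
    ∣ A ∪ B ∣                                       ≤⟨ hallXY (A ∪ B) A∪B⊆X ⟩
    ∣ Y ∩ N G (A ∪ B) ∣                             ≤⟨ p⊆q⇒∣p∣≤∣q∣ split ⟩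
    ∣ (Y ∩ N G A) ∪ ((Y ─ N G A) ∩ N G B) ∣         ≤⟨ ∣p∪q∣≤∣p∣+∣q∣ (Y ∩ N G A) _ ⟩
    ∣ Y ∩ N G A ∣ + ∣ (Y ─ N G A) ∩ N G B ∣         ≤⟨ +-monoˡ-≤ _ tightA ⟩
    ∣ A ∣ + ∣ (Y ─ N G A) ∩ N G B ∣                 ∎)
    where
    open ≤-Reasoning
    A-B-disjoint : Disjoint A B
    A-B-disjoint x∈A x∈B = x∈p─q⇒x∉q (B⊆X─A x∈B) x∈A
    A∪B⊆X : A ∪ B ⊆ X
    A∪B⊆X x∈A∪B = [ A⊆X , (λ x∈B → p─q⊆p X A (B⊆X─A x∈B)) ]′ (x∈p∪q⁻ A B x∈A∪B)
    split : Y ∩ N G (A ∪ B) ⊆ (Y ∩ N G A) ∪ ((Y ─ N G A) ∩ N G B)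
    split {y} y∈ with x∈p∩q⁻ Y _ y∈ | y ∈? N G A
    ... | y∈Y , _      | yes y∈NA = x∈p∪q⁺ (inj₁ (x∈p∩q⁺ (y∈Y , y∈NA)))
    ... | y∈Y , y∈NA∪B | no  y∉NA = x∈p∪q⁺ (inj₂ (x∈p∩q⁺ (x∈p∧x∉q⇒x∈p─q y∈Y y∉NA , y∈NB)))
      where
      y∈NB : y ∈ N G B
      y∈NB = [ (λ y∈NA → contradiction y∈NA y∉NA) , (λ y∈NB → y∈NB) ]′
               (x∈p∪q⁻ (N G A) (N G B) (N-∪ G A B y∈NA∪B))

  split-at-tight : ∀ {k X Y A} → HallBelow k → ∣ X ∣ ≤ suc k → HallCondition X Y →
                   Tight X Y A → SDR X Y
  split-at-tight {k} {X} {Y} {A} ih ∣X∣≤1+k hallXY (A⊆X , 1≤∣A∣ , ∣A∣<∣X∣ , tightA) =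
    sdr-glue sA (sdr-weaken sRest (p─q⊆p Y (N G A))) apart
    where
    sA : SDR A Y
    sA = ih A Y (≤-pred (≤-trans ∣A∣<∣X∣ ∣X∣≤1+k)) (λ B B⊆A → hallXY B (⊆-trans B⊆A A⊆X))
    ∣X─A∣<∣X∣ : ∣ X ─ A ∣ < ∣ X ∣
    ∣X─A∣<∣X∣ with 1≤∣p∣⇒Nonempty 1≤∣A∣
    ... | a , a∈A = p∩q≢∅⇒∣p─q∣<∣p∣ X A (a , x∈p∩q⁺ (A⊆X a∈A , a∈A))
    sRest : SDR (X ─ A) (Y ─ N G A)
    sRest = ih (X ─ A) (Y ─ N G A) (≤-pred (≤-trans ∣X─A∣<∣X∣ ∣X∣≤1+k))
               (hall-outside-tight {X} {Y} {A} hallXY A⊆X tightA)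
    apart : ∀ {x x′} → x ∈ A → x′ ∈ X ─ A → rep sA x ≢ rep sRest x′
    apart x∈A x′∈X─A same = x∈p─q⇒x∉q (rep-∈ sRest x′∈X─A)
      (subst (_∈ N G A) same (∈N⁺ G x∈A (rep-adj sA x∈A)))

  -- Without tight sets every nonempty B ⊆ X - x₀ has more than |B| neighbours
  -- in Y, so Hall's condition survives the removal of any one vertex y₀ from Y.
  hall-minus-vertex : ∀ {X Y x₀ y₀} → x₀ ∈ X → (∀ A → ¬ Tight X Y A) →
                      HallCondition (X - x₀) (Y - y₀)
  hall-minus-vertex {X} {Y} {x₀} {y₀} x₀∈X loose B B⊆X-x₀ with 1 ≤? ∣ B ∣
  ... | no  ∣B∣≱1 = subst (_≤ ∣ (Y - y₀) ∩ N G B ∣) (sym (n<1⇒n≡0 (≰⇒> ∣B∣≱1))) z≤n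
  ... | yes 1≤∣B∣ = ≤-pred (begin-strict
    ∣ B ∣                                  <⟨ ≰⇒> (λ notMore → loose B (B⊆X , 1≤∣B∣ , ∣B∣<∣X∣ , notMore)) ⟩
    ∣ Y ∩ N G B ∣                          ≤⟨ p⊆q⇒∣p∣≤∣q∣ split ⟩
    ∣ ⁅ y₀ ⁆ ∪ ((Y - y₀) ∩ N G B) ∣        ≤⟨ ∣p∪q∣≤∣p∣+∣q∣ ⁅ y₀ ⁆ ((Y - y₀) ∩ N G B) ⟩
    ∣ ⁅ y₀ ⁆ ∣ + ∣ (Y - y₀) ∩ N G B ∣      ≡⟨ cong (_+ ∣ (Y - y₀) ∩ N G B ∣) (∣⁅x⁆∣≡1 y₀) ⟩
    suc ∣ (Y - y₀) ∩ N G B ∣               ∎)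
    where
    open ≤-Reasoning
    B⊆X : B ⊆ X
    B⊆X x∈B = p─q⊆p X ⁅ x₀ ⁆ (B⊆X-x₀ x∈B)
    ∣B∣<∣X∣ : ∣ B ∣ < ∣ X ∣
    ∣B∣<∣X∣ = ≤-<-trans (p⊆q⇒∣p∣≤∣q∣ B⊆X-x₀) (x∈p⇒∣p-x∣<∣p∣ x₀∈X)
    split : Y ∩ N G B ⊆ ⁅ y₀ ⁆ ∪ ((Y - y₀) ∩ N G B)
    split {y} y∈ with x∈p∩q⁻ Y _ y∈ | y ∈? ⁅ y₀ ⁆
    ... | _         | yes y∈⁅y₀⁆ = x∈p∪q⁺ (inj₁ y∈⁅y₀⁆)
    ... | y∈Y , y∈NB | no  y∉⁅y₀⁆ = x∈p∪q⁺ (inj₂ (x∈p∩q⁺ (x∈p∧x∉q⇒x∈p─q y∈Y y∉⁅y₀⁆ , y∈NB)))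

  split-at-vertex : ∀ {k X Y x₀} → HallBelow k → ∣ X ∣ ≤ suc k → HallCondition X Y →
                    (∀ A → ¬ Tight X Y A) → x₀ ∈ X → SDR X Y
  split-at-vertex {k} {X} {Y} {x₀} ih ∣X∣≤1+k hallXY loose x₀∈X with
    1≤∣p∣⇒Nonempty (subst (_≤ ∣ Y ∩ N G ⁅ x₀ ⁆ ∣) (∣⁅x⁆∣≡1 x₀) (hallXY ⁅ x₀ ⁆ ⁅x₀⁆⊆X))
    where
    ⁅x₀⁆⊆X : ⁅ x₀ ⁆ ⊆ X
    ⁅x₀⁆⊆X x∈⁅x₀⁆ = subst (_∈ X) (sym (x∈⁅y⁆⇒x≡y x₀ x∈⁅x₀⁆)) x₀∈X
  ... | y₀ , y₀∈Y∩N⁅x₀⁆ with x∈p∩q⁻ Y _ y₀∈Y∩N⁅x₀⁆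
  ...   | y₀∈Y , y₀∈N⁅x₀⁆ with ∈N⁻ G y₀∈N⁅x₀⁆
  ...     | u , u∈⁅x₀⁆ , uy₀ = sdr-glue s₀ (sdr-weaken sRest (p─q⊆p Y ⁅ y₀ ⁆)) apart
    where
    x₀y₀ : adj G x₀ y₀ ≡ true
    x₀y₀ = subst (λ x → adj G x y₀ ≡ true) (x∈⁅y⁆⇒x≡y x₀ u∈⁅x₀⁆) uy₀
    s₀ : SDR ⁅ x₀ ⁆ Y
    s₀ = record
      { rep     = λ _ → y₀
      ; rep-adj = λ x∈⁅x₀⁆ → subst (λ x → adj G x y₀ ≡ true) (sym (x∈⁅y⁆⇒x≡y x₀ x∈⁅x₀⁆)) x₀y₀
      ; rep-∈   = λ _ → y₀∈Y
      ; rep-inj = λ x∈⁅x₀⁆ x′∈⁅x₀⁆ _ → trans (x∈⁅y⁆⇒x≡y x₀ x∈⁅x₀⁆) (sym (x∈⁅y⁆⇒x≡y x₀ x′∈⁅x₀⁆))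
      }
    sRest : SDR (X - x₀) (Y - y₀)
    sRest = ih (X - x₀) (Y - y₀) (≤-pred (≤-trans (x∈p⇒∣p-x∣<∣p∣ x₀∈X) ∣X∣≤1+k))
               (hall-minus-vertex {X} {Y} {x₀} {y₀} x₀∈X loose)
    apart : ∀ {x x′} → x ∈ ⁅ x₀ ⁆ → x′ ∈ X - x₀ → y₀ ≢ rep sRest x′
    apart _ x′∈X-x₀ same = x∈p─q⇒x∉q (rep-∈ sRest x′∈X-x₀) (subst (_∈ ⁅ y₀ ⁆) same (x∈⁅x⁆ y₀))

  hall-bounded : ∀ k → HallBelow k
  hall-bounded zero    X Y ∣X∣≤0 _ = sdr-empty λ (_ , x∈X) → contradiction (≤-trans (x∈p⇒1≤∣p∣ x∈X) ∣X∣≤0) λ ()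
  hall-bounded (suc k) X Y ∣X∣≤1+k hallXY with anySubset? (tight? X Y)
  ... | yes (A , tight) = split-at-tight (hall-bounded k) ∣X∣≤1+k hallXY tight
  ... | no  noTight with nonempty? X
  ...   | yes (x₀ , x₀∈X) = split-at-vertex (hall-bounded k) ∣X∣≤1+k hallXY (λ A t → noTight (A , t)) x₀∈X
  ...   | no  empty       = sdr-empty empty

  hall : ∀ {X Y} → HallCondition X Y → SDR X Y
  hall {X} {Y} = hall-bounded ∣ X ∣ X Y ≤-refl

module _ {n : ℕ} (G : Graph n) where
  open SDR

  sdr⇒matching : ∀ {X Y} → Disjoint X Y → SDR G X Y → ∃[ M ] Matching G M × length M ≡ ∣ X ∣
  sdr⇒matching {X} {Y} disjoint s =
    List.map edge (members X) ,
    (All.map⁺ (All.map (rep-adj s) (members-∈ X)) , pairs (members-∈ X) (members-distinct X)) ,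
    trans (length-map edge (members X)) (length-members X)
    where
    edge : Fin n → Fin n × Fin n
    edge x = x , rep s x
    nonIncident : ∀ {x x′} → x ∈ X → x′ ∈ X → x ≢ x′ → NonIncident (edge x) (edge x′)
    nonIncident x∈X x′∈X x≢x′ =
      x≢x′ ,
      (λ x≡r → disjoint x∈X (subst (_∈ Y) (sym x≡r) (rep-∈ s x′∈X))) ,
      (λ r≡x′ → disjoint x′∈X (subst (_∈ Y) r≡x′ (rep-∈ s x∈X))) ,
      (λ r≡r′ → x≢x′ (rep-inj s x∈X x′∈X r≡r′))
    pairs : ∀ {xs} → All (_∈ X) xs → AllPairs _≢_ xs → AllPairs NonIncident (List.map edge xs)
    pairs []            []                = []
    pairs (x∈X ∷ xs⊆X) (x∉xs ∷ distinct) =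
      All.map⁺ (All.zipWith (λ (x′∈X , x≢x′) → nonIncident x∈X x′∈X x≢x′) (xs⊆X , x∉xs))
      ∷ pairs xs⊆X distinct

  -- Larson: for a critical independent set I, every A ⊆ N(I) has at least |A|
  -- neighbours in I.  Otherwise I′ = I ─ N(A) would have a larger surplus,
  -- since N(I′) misses A.
  critical⇒hall : ∀ {I} → CriticalIndependent G I → HallCondition G (N G I) I
  critical⇒hall {I} (indI , critI) A A⊆NI = +-cancelˡ-≤ (∣ I′ ∣ + ∣ N G I ─ A ∣) _ _ (begin
    (∣ I′ ∣ + ∣ N G I ─ A ∣) + ∣ A ∣           ≡⟨ +-assoc ∣ I′ ∣ _ _ ⟩
    ∣ I′ ∣ + (∣ N G I ─ A ∣ + ∣ A ∣)           ≡⟨ cong (∣ I′ ∣ +_) (trans (+-comm _ ∣ A ∣) (∣p∣+∣q─p∣≡∣q∣ A⊆NI)) ⟩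
    ∣ I′ ∣ + ∣ N G I ∣                         ≤⟨ ⊖-≤⇒ (∣ I ∣) (∣ N G I ∣) (∣ I′ ∣) (∣ N G I′ ∣) (critI I′ indI′) ⟩
    ∣ I ∣ + ∣ N G I′ ∣                         ≤⟨ +-monoʳ-≤ ∣ I ∣ (p⊆q⇒∣p∣≤∣q∣ NI′⊆NI─A) ⟩
    ∣ I ∣ + ∣ N G I ─ A ∣                      ≡⟨ cong (_+ ∣ N G I ─ A ∣) (∣p∣≡∣p∩q∣+∣p─q∣ I (N G A)) ⟩
    (∣ I ∩ N G A ∣ + ∣ I′ ∣) + ∣ N G I ─ A ∣   ≡⟨ rearrange (∣ I ∩ N G A ∣) (∣ I′ ∣) (∣ N G I ─ A ∣) ⟩
    (∣ I′ ∣ + ∣ N G I ─ A ∣) + ∣ I ∩ N G A ∣   ∎)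
    where
    open ≤-Reasoning
    I′ : Subset n
    I′ = I ─ N G A
    indI′ : Independent G I′
    indI′ = independent-⊆ G (p─q⊆p I (N G A)) indI
    NI′⊆NI─A : N G I′ ⊆ N G I ─ A
    NI′⊆NI─A v∈NI′ with ∈N⁻ G v∈NI′
    ... | u , u∈I′ , uv = x∈p∧x∉q⇒x∈p─q (∈N⁺ G (p─q⊆p I (N G A) u∈I′) uv)
                            (λ v∈A → x∈p─q⇒x∉q u∈I′ (∈N-sym G v∈A uv))
    rearrange : ∀ i r d → (i + r) + d ≡ (r + d) + i
    rearrange = solve-∀

  critical⇒matching : ∀ {I} → CriticalIndependent G I → ∃[ M ] Matching G M × length M ≡ ∣ N G I ∣
  critical⇒matching crit =
    sdr⇒matching (independent⇒N-disjoint G (proj₁ crit)) (hall G (critical⇒hall crit))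

  -- A maximum independent set S dominates: a vertex outside S without a
  -- neighbour in S could be added to S.
  maximum⇒dominating : ∀ {S} → Independent G S → (∀ J → Independent G J → ∣ J ∣ ≤ ∣ S ∣) →
                       ∁ S ⊆ N G S
  maximum⇒dominating {S} indS maxS {v} v∈∁S with v ∈? N G S
  ... | yes v∈NS = v∈NS
  ... | no  v∉NS = contradiction (maxS (S ∪ ⁅ v ⁆) indS+v) (<⇒≱ ∣S∣<∣S+v∣)
    where
    ∣S∣<∣S+v∣ : ∣ S ∣ < ∣ S ∪ ⁅ v ⁆ ∣
    ∣S∣<∣S+v∣ = subst (∣ S ∣ <_)
      (sym (trans (∣p∪q∣≡∣p∣+∣q∣ S ⁅ v ⁆ (λ x∈S x∈⁅v⁆ → x∈∁p⇒x∉p v∈∁S (subst (_∈ S) (x∈⁅y⁆⇒x≡y v x∈⁅v⁆) x∈S)))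
                  (trans (cong (∣ S ∣ +_) (∣⁅x⁆∣≡1 v)) (+-comm ∣ S ∣ 1))))
      (n<1+n ∣ S ∣)
    not-adjacent : ∀ {u} → u ∈ S → adj G u v ≡ false
    not-adjacent {u} u∈S with adj G u v in uv
    ... | false = refl
    ... | true  = contradiction (∈N⁺ G u∈S uv) v∉NS
    indS+v : Independent G (S ∪ ⁅ v ⁆)
    indS+v x y x∈ y∈ with x∈p∪q⁻ S ⁅ v ⁆ x∈ | x∈p∪q⁻ S ⁅ v ⁆ y∈
    ... | inj₁ x∈S | inj₁ y∈S = indS x y x∈S y∈S
    ... | inj₁ x∈S | inj₂ y∈⁅v⁆ rewrite x∈⁅y⁆⇒x≡y v y∈⁅v⁆ = not-adjacent x∈S
    ... | inj₂ x∈⁅v⁆ | inj₁ y∈S rewrite x∈⁅y⁆⇒x≡y v x∈⁅v⁆ = trans (Graph.sym G v y) (not-adjacent y∈S)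
    ... | inj₂ x∈⁅v⁆ | inj₂ y∈⁅v⁆ rewrite x∈⁅y⁆⇒x≡y v x∈⁅v⁆ | x∈⁅y⁆⇒x≡y v y∈⁅v⁆ = irrefl G v

  -- If an independent set S and a matching M together account for all vertices
  -- (|S| + |M| = n), then S is critical: every independent J satisfies
  -- |J| − |N(J)| ≤ n − 2|M| = |S| − |M| ≤ |S| − |N(S)|.
  complementary⇒critical : ∀ {S M} → Independent G S → Matching G M → ∣ S ∣ + length M ≡ n →
                           CriticalIndependent G S
  complementary⇒critical {S} {M} indS matchingM ∣S∣+∣M∣≡n =
    indS , λ J indJ → ⇒⊖-≤ (∣ S ∣) (∣ N G S ∣) (∣ J ∣) (∣ N G J ∣) (begin
      ∣ J ∣ + ∣ N G S ∣                       ≤⟨ +-mono-≤ (∣J∣≤∣NJ∣+uncovered G indJ matchingM) ∣NS∣≤∣M∣ ⟩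
      (∣ N G J ∣ + uncovered) + length M      ≡⟨ +-assoc ∣ N G J ∣ uncovered (length M) ⟩
      ∣ N G J ∣ + (uncovered + length M)      ≡⟨ cong (∣ N G J ∣ +_) uncovered+∣M∣≡∣S∣ ⟩
      ∣ N G J ∣ + ∣ S ∣                       ≡⟨ +-comm (∣ N G J ∣) (∣ S ∣) ⟩
      ∣ S ∣ + ∣ N G J ∣                       ∎)
    where
    open ≤-Reasoning
    uncovered : ℕ
    uncovered = ∣ ∁ (covered M) ∣
    ∣NS∣≤∣M∣ : ∣ N G S ∣ ≤ length M
    ∣NS∣≤∣M∣ = ≤-trans (p⊆q⇒∣p∣≤∣q∣ (λ v∈NS → x∉p⇒x∈∁p (independent⇒N-disjoint G indS v∈NS)))
                       (≤-reflexive (+-cancelˡ-≡ ∣ S ∣ _ _ (trans (∣p∣+∣∁p∣≡n S) (sym ∣S∣+∣M∣≡n))))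
    uncovered+∣M∣≡∣S∣ : uncovered + length M ≡ ∣ S ∣
    uncovered+∣M∣≡∣S∣ = +-cancelʳ-≡ (length M) _ _ (begin-equality
      (uncovered + length M) + length M        ≡⟨ rearrange uncovered (length M) ⟩
      (length M + length M) + uncovered        ≡⟨ cong (_+ uncovered) (∣covered∣ G M matchingM) ⟨
      ∣ covered M ∣ + uncovered                ≡⟨ ∣p∣+∣∁p∣≡n (covered M) ⟩
      n                                        ≡⟨ ∣S∣+∣M∣≡n ⟨
      ∣ S ∣ + length M                         ∎)
      where
      rearrange : ∀ u m → (u + m) + m ≡ (m + m) + u
      rearrange = solve-∀

  -- If α = α′, a maximum critical independent set I dominates, so Larson's
  -- matching of N(I) into I has at least n − α = τ edges; hence μ = τ.
  α≡α′⇒τ≡μ : ∀ {a a′ t m} → IsIndependenceNumber G a → IsCriticalIndependenceNumber G a′ →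
             IsVertexCoverNumber G t → IsMatchingNumber G m → a ≡ a′ → t ≡ m
  α≡α′⇒τ≡μ {a} {a′} {t} {m} isα ((I , critI , ∣I∣≡a′) , _) isτ@((C , coverC , ∣C∣≡t) , _)
           ((_ , matching , ∣M∣≡m) , maxμ) a≡a′ with critical⇒matching critI
  ... | M′ , matching′ , ∣M′∣≡∣NI∣ = ≤-antisym t≤m m≤t
    where
    open ≤-Reasoning
    m≤t : m ≤ t
    m≤t = subst₂ _≤_ ∣M∣≡m ∣C∣≡t (matching≤cover G matching coverC)
    maxI : ∀ J → Independent G J → ∣ J ∣ ≤ ∣ I ∣
    maxI J indJ = subst (∣ J ∣ ≤_) (trans a≡a′ (sym ∣I∣≡a′)) (proj₂ isα J indJ)
    ∣∁I∣≡t : ∣ ∁ I ∣ ≡ t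
    ∣∁I∣≡t = +-cancelˡ-≡ a _ _ (begin-equality
      a + ∣ ∁ I ∣      ≡⟨ cong (_+ ∣ ∁ I ∣) (trans a≡a′ (sym ∣I∣≡a′)) ⟩
      ∣ I ∣ + ∣ ∁ I ∣  ≡⟨ ∣p∣+∣∁p∣≡n I ⟩
      n                ≡⟨ α+τ≡n G isα isτ ⟨
      a + t            ∎)
    t≤m : t ≤ m
    t≤m = begin
      t            ≡⟨ ∣∁I∣≡t ⟨
      ∣ ∁ I ∣      ≤⟨ p⊆q⇒∣p∣≤∣q∣ (maximum⇒dominating (proj₁ critI) maxI) ⟩
      ∣ N G I ∣    ≡⟨ ∣M′∣≡∣NI∣ ⟨
      length M′    ≤⟨ maxμ M′ matching′ ⟩
      m            ∎

  -- If τ = μ, a maximum independent set S and a maximum matching satisfy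
  -- |S| + μ = α + τ = n, so S is critical and α ≤ α′.
  τ≡μ⇒α≡α′ : ∀ {a a′ t m} → IsIndependenceNumber G a → IsCriticalIndependenceNumber G a′ →
             IsVertexCoverNumber G t → IsMatchingNumber G m → t ≡ m → a ≡ a′
  τ≡μ⇒α≡α′ {a} {a′} {t} {m} isα@((S , indS , ∣S∣≡a) , maxα) ((I , critI , ∣I∣≡a′) , maxα′) isτ
           ((M , matching , ∣M∣≡m) , _) t≡m = ≤-antisym a≤a′ a′≤a
    where
    a′≤a : a′ ≤ a
    a′≤a = subst (_≤ a) ∣I∣≡a′ (maxα I (proj₁ critI))
    ∣S∣+∣M∣≡n : ∣ S ∣ + length M ≡ n
    ∣S∣+∣M∣≡n = trans (cong₂ _+_ ∣S∣≡a (trans ∣M∣≡m (sym t≡m))) (α+τ≡n G isα isτ)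
    a≤a′ : a ≤ a′
    a≤a′ = subst (_≤ a′) ∣S∣≡a (maxα′ S (complementary⇒critical indS matching ∣S∣+∣M∣≡n))

theorem3p1 : ∀ {n} (G : Graph n) (a a' t m : ℕ) →
    IsIndependenceNumber G a →
    IsCriticalIndependenceNumber G a' →
    IsVertexCoverNumber G t →
    IsMatchingNumber G m →
    (a ≡ a') ⇔ (t ≡ m)
theorem3p1 G a a' t m isα isα′ isτ isμ =
  mk⇔ (α≡α′⇒τ≡μ G isα isα′ isτ isμ) (τ≡μ⇒α≡α′ G isα isα′ isτ isμ)
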